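{- For every integer $t\ge 2$ there exists a sequence of finite hypergraphs $(H_i)_{i\in\mathbb{N}}$ such that $\chi_{CF}(H_i)=2$ for all $i$ and $\lim_{i\to+\infty}\chi^t_{CF}(H_i)=+\infty$.
   Context: A hypergraph $H=(V,\mathcal{E})$ has finite vertex set $V$ and $\mathcal{E}\subseteq 2^V$. A conflict-free (CF) colouring of $H$ is a colouring $\varphi$ of $V$ such that every nonempty $h\in\mathcal{E}$ contains a vertex $x$ with $\varphi(y)\neq\varphi(x)$ for all $y\in h\setminus\{x\}$; $\chi_{CF}(H)$ is the least number of colours in such a colouring. For $t\in\mathbb{N}$, a $t$-subset-CF-colouring with $k$ colours is a function $\varphi$ from the $t$-element subsets of $V$ to a $k$-element set such that every $h\in\mathcal{E}$ with $|h|>t$ contains a $t$-subset $s\subseteq h$ whose colour differs from the colours of all other $t$-subsets of $h$; $\chi^t_{CF}(H)$ is the least such $k$. -}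

module Defs where

open import Data.Nat using (ℕ; _<_; _≤_)
open import Data.Fin using (Fin)
open import Data.Fin.Subset using (Subset; _∈_; _⊆_; ∣_∣; Nonempty)
open import Data.Product using (Σ; ∃; _×_)
open import Relation.Binary.PropositionalEquality using (_≡_; _≢_)
open import Relation.Nullary using (¬_)

record Hypergraph : Set where
  field
    n     : ℕ
    m     : ℕ
    edge  : Fin m → Subset n

open Hypergraph public

IsCFColouring : (H : Hypergraph) (k : ℕ) → (Fin (n H) → Fin k) → Set
IsCFColouring H k φ =
  ∀ (e : Fin (m H)) → Nonempty (edge H e) →
    ∃ λ x → x ∈ edge H e × (∀ y → y ∈ edge H e → y ≢ x → φ y ≢ φ x)

CFColourable : Hypergraph → ℕ → Set
CFColourable H k = ∃ λ (φ : Fin (n H) → Fin k) → IsCFColouring H k φ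

χCF≡ : Hypergraph → ℕ → Set
χCF≡ H k = CFColourable H k × (∀ j → j < k → ¬ CFColourable H j)

-- t-subset CF colouring with k colours.  φ is given on all subsets of V,
-- but only its values on t-element subsets are ever used, so this is the
-- same as a function from the t-subsets of V to a k-element set.
IsTSubsetCFColouring : (t : ℕ) (H : Hypergraph) (k : ℕ) → (Subset (n H) → Fin k) → Set
IsTSubsetCFColouring t H k φ =
  ∀ (e : Fin (m H)) → t < ∣ edge H e ∣ →
    ∃ λ s → s ⊆ edge H e × ∣ s ∣ ≡ t ×
      (∀ s′ → s′ ⊆ edge H e → ∣ s′ ∣ ≡ t → s′ ≢ s → φ s′ ≢ φ s)

TSubsetCFColourable : ℕ → Hypergraph → ℕ → Set
TSubsetCFColourable t H k =
  ∃ λ (φ : Subset (n H) → Fin k) → IsTSubsetCFColouring t H k φ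

χtCF≥ : ℕ → Hypergraph → ℕ → Set
χtCF≥ t H M = ∀ k → k < M → ¬ TSubsetCFColourable t H k

-- In the cone over n vertices (apex 0, one edge {0} ∪ S for every S ⊆ {1,…,n})
-- the apex alone gets a unique colour, so two colours are conflict-free.
-- For t-subsets, take any edge A and its uniquely coloured t-subset s; as t ≥ 2,
-- s contains a vertex w other than the apex, and every t-subset of the edge
-- A ∖ {w} differs from s, hence avoids the colour of s.  Peeling off one colour
-- per step this way shows that the t-subsets of a cone edge of size a use more
-- than a − t − 1 colours, which is unbounded as n grows.
module Submission where

open import Defs
open import Data.Nat using (ℕ; zero; suc; _+_; _^_; _≤_; _<_; z≤n; s≤s)
open import Data.Nat.Properties
  using (≤-trans; ≤-reflexive; m≤n⇒m≤1+n; <-irrefl; <⇒≤; +-suc; +-identityʳ; +-monoʳ-≤; m≤m+n; n≤1+n)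
open import Data.Fin using (Fin; zero; suc; finToFun; funToFin; _≟_)
open import Data.Fin.Properties using (¬Fin0; 0≢1+n; 2↔Bool; finToFun-funToFin)
open import Data.Fin.Subset using (Subset; inside; outside; _∈_; _∉_; _⊆_; ∣_∣; Nonempty; ⊤; ⁅_⁆; _-_)
open import Data.Fin.Subset.Properties
  using (∈⊤; ∣⊤∣≡n; p─⊥≡p; p─q⊆p; ⊆-trans; x∈p∧x≢y⇒x∈p-y; x∈p⇒∣p-x∣<∣p∣)
open import Data.Vec using (_∷_; here; there; tabulate; lookup)
open import Data.Vec.Properties using (tabulate-cong; tabulate∘lookup)
open import Data.Product using (Σ; ∃; _×_; _,_; map; map₂)
open import Function using (_∘_)
open import Function.Bundles using (Inverse)
open import Relation.Binary.PropositionalEquality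
  using (_≡_; _≢_; refl; sym; cong; subst; module ≡-Reasoning)
open import Relation.Nullary using (¬_; yes; no)

private
  variable
    N k t : ℕ

subsetAt : Fin (2 ^ N) → Subset N
subsetAt i = tabulate (Inverse.to 2↔Bool ∘ finToFun i)

indexOf : Subset N → Fin (2 ^ N)
indexOf p = funToFin (Inverse.from 2↔Bool ∘ lookup p)

subsetAt-indexOf : (p : Subset N) → subsetAt (indexOf p) ≡ p
subsetAt-indexOf p = begin
  tabulate (to ∘ finToFun (funToFin (from ∘ lookup p)))
    ≡⟨ tabulate-cong (cong to ∘ finToFun-funToFin (from ∘ lookup p)) ⟩
  tabulate (to ∘ from ∘ lookup p)
    ≡⟨ tabulate-cong (strictlyInverseˡ ∘ lookup p) ⟩
  tabulate (lookup p)
    ≡⟨ tabulate∘lookup p ⟩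
  p ∎
  where
  open ≡-Reasoning
  open Inverse 2↔Bool using (to; from; strictlyInverseˡ)

x∉p-x : (p : Subset N) (x : Fin N) → x ∉ p - x
x∉p-x (_ ∷ p) (suc x) (there x∈p-x) = x∉p-x p x x∈p-x

∣p∣≤1+∣p-x∣ : (p : Subset N) (x : Fin N) → ∣ p ∣ ≤ suc ∣ p - x ∣
∣p∣≤1+∣p-x∣ (inside  ∷ p) zero    = s≤s (≤-reflexive (cong ∣_∣ (sym (p─⊥≡p p))))
∣p∣≤1+∣p-x∣ (outside ∷ p) zero    = m≤n⇒m≤1+n (≤-reflexive (cong ∣_∣ (sym (p─⊥≡p p))))
∣p∣≤1+∣p-x∣ (inside  ∷ p) (suc x) = s≤s (∣p∣≤1+∣p-x∣ p x)
∣p∣≤1+∣p-x∣ (outside ∷ p) (suc x) = ∣p∣≤1+∣p-x∣ p x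

0<∣p∣⇒Nonempty : (p : Subset N) → 0 < ∣ p ∣ → Nonempty p
0<∣p∣⇒Nonempty (inside  ∷ p) _ = zero , here
0<∣p∣⇒Nonempty (outside ∷ p) 0<∣p∣ = map suc there (0<∣p∣⇒Nonempty p 0<∣p∣)

2≤∣p∣⇒∃suc∈p : (p : Subset (suc N)) → 2 ≤ ∣ p ∣ → ∃ λ x → suc x ∈ p
2≤∣p∣⇒∃suc∈p (inside  ∷ p) (s≤s 1≤∣p∣) = map₂ there (0<∣p∣⇒Nonempty p 1≤∣p∣)
2≤∣p∣⇒∃suc∈p (outside ∷ p) 2≤∣p∣      = map₂ there (0<∣p∣⇒Nonempty p (≤-trans (s≤s z≤n) 2≤∣p∣))

fin1-≡ : (a b : Fin 1) → a ≡ b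
fin1-≡ zero zero = refl

-- Unfolds to the body of IsTSubsetCFColouring, so the two are interchangeable definitionally.
UniquelyColoured : (t : ℕ) → (Subset N → Fin k) → Subset N → Subset N → Set
UniquelyColoured t φ A s =
  s ⊆ A × ∣ s ∣ ≡ t × (∀ s′ → s′ ⊆ A → ∣ s′ ∣ ≡ t → s′ ≢ s → φ s′ ≢ φ s)

TSubsetColoursIn : (t : ℕ) → (Subset N → Fin k) → Subset N → Subset k → Set
TSubsetColoursIn t φ A C = ∀ {s} → s ⊆ A → ∣ s ∣ ≡ t → φ s ∈ C

module _ (φ : Subset N → Fin k) (Edge : Subset N → Set)
  (uniquelyColoured : ∀ {A} → Edge A → t < ∣ A ∣ → ∃ (UniquelyColoured t φ A))
  (shrink : ∀ {A s} → Edge A → s ⊆ A → ∣ s ∣ ≡ t → ∃ λ w → w ∈ s × Edge (A - w))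
  where

  peel : ∀ j {A} (C : Subset k) → Edge A → t + suc j < ∣ A ∣ → TSubsetColoursIn t φ A C →
    ∃ λ A′ → ∃ λ c → Edge A′ × t + j < ∣ A′ ∣ × c ∈ C × TSubsetColoursIn t φ A′ (C - c)
  peel j {A} C edgeA t+1+j<∣A∣ coloursIn
    with uniquelyColoured edgeA (≤-trans (s≤s (m≤m+n t (suc j))) t+1+j<∣A∣)
  ... | s , s⊆A , ∣s∣≡t , unique with shrink edgeA s⊆A ∣s∣≡t
  ... | w , w∈s , edgeA-w =
    A - w , φ s , edgeA-w , t+j<∣A-w∣ , coloursIn s⊆A ∣s∣≡t , avoid
    where
    t+j<∣A-w∣ : t + j < ∣ A - w ∣
    t+j<∣A-w∣ with s≤s t+j<∣A-w∣′ ←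
      ≤-trans (subst (_< ∣ A ∣) (+-suc t j) t+1+j<∣A∣) (∣p∣≤1+∣p-x∣ A w)
      = t+j<∣A-w∣′

    -- s contains w, so it is none of the t-subsets of A - w.
    avoid : TSubsetColoursIn t φ (A - w) (C - φ s)
    avoid {s′} s′⊆A-w ∣s′∣≡t = x∈p∧x≢y⇒x∈p-y (coloursIn s′⊆A ∣s′∣≡t)
      (unique s′ s′⊆A ∣s′∣≡t (λ { refl → x∉p-x A w (s′⊆A-w w∈s) }))
      where
      s′⊆A : s′ ⊆ A
      s′⊆A = ⊆-trans s′⊆A-w (p─q⊆p A ⁅ w ⁆)

  t-subset-colours-exceed : ∀ j {A} (C : Subset k) → Edge A → t + j < ∣ A ∣ →
    TSubsetColoursIn t φ A C → j < ∣ C ∣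
  t-subset-colours-exceed zero {A} C edgeA t<∣A∣ coloursIn
    with s , s⊆A , ∣s∣≡t , _ ← uniquelyColoured edgeA (subst (_< ∣ A ∣) (+-identityʳ t) t<∣A∣)
    = ≤-trans (s≤s z≤n) (x∈p⇒∣p-x∣<∣p∣ (coloursIn s⊆A ∣s∣≡t))
  t-subset-colours-exceed (suc j) C edgeA t+1+j<∣A∣ coloursIn
    with A′ , c , edgeA′ , t+j<∣A′∣ , c∈C , coloursIn′ ← peel j C edgeA t+1+j<∣A∣ coloursIn
    = ≤-trans (s≤s (t-subset-colours-exceed j (C - c) edgeA′ t+j<∣A′∣ coloursIn′))
              (x∈p⇒∣p-x∣<∣p∣ c∈C)

cone : ℕ → Hypergraph
cone N = record { n = suc N ; m = 2 ^ N ; edge = λ e → inside ∷ subsetAt e }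

edge-cone-indexOf : (S : Subset N) → edge (cone N) (indexOf S) ≡ inside ∷ S
edge-cone-indexOf S = cong (inside ∷_) (subsetAt-indexOf S)

apexColouring : Fin (suc N) → Fin 2
apexColouring zero    = suc zero
apexColouring (suc _) = zero

apexColouring-isCF : IsCFColouring (cone N) 2 apexColouring
apexColouring-isCF {N} e _ = zero , here , apexUnique
  where
  apexUnique : ∀ y → y ∈ edge (cone N) e → y ≢ zero → apexColouring {N} y ≢ apexColouring {N} zero
  apexUnique zero    _ y≢0 = λ _ → y≢0 refl
  apexUnique (suc _) _ _   = λ ()

¬CFColourable-1 : (H : Hypergraph) (e : Fin (m H)) {x y : Fin (n H)} →
  x ≢ y → x ∈ edge H e → y ∈ edge H e → ¬ CFColourable H 1
¬CFColourable-1 H e {x} {y} x≢y x∈e y∈e (φ , cf)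
  with z , z∈e , unique ← cf e (x , x∈e)
  with x ≟ z
... | yes refl = unique y y∈e (x≢y ∘ sym) (fin1-≡ (φ y) (φ x))
... | no x≢z   = unique x x∈e x≢z (fin1-≡ (φ x) (φ z))

χCF-cone : ∀ N → χCF≡ (cone (suc N)) 2
χCF-cone N = (apexColouring , apexColouring-isCF) , fewerColours
  where
  edge⊤ : edge (cone (suc N)) (indexOf {suc N} ⊤) ≡ inside ∷ ⊤
  edge⊤ = edge-cone-indexOf {suc N} ⊤

  fewerColours : ∀ j → j < 2 → ¬ CFColourable (cone (suc N)) j
  fewerColours 0 _ (φ , _) = ¬Fin0 (φ zero)
  fewerColours 1 _ = ¬CFColourable-1 (cone (suc N)) (indexOf {suc N} ⊤) 0≢1+n
    (subst (zero ∈_) (sym edge⊤) here) (subst (suc zero ∈_) (sym edge⊤) (there ∈⊤))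
  fewerColours (suc (suc _)) (s≤s (s≤s ()))

cone-uniquelyColoured : {φ : Subset (suc N) → Fin k} → IsTSubsetCFColouring t (cone N) k φ →
  ∀ {A} → zero ∈ A → t < ∣ A ∣ → ∃ (UniquelyColoured t φ A)
cone-uniquelyColoured {N} {t = t} {φ} cf {inside ∷ S} here =
  subst (λ A → t < ∣ A ∣ → ∃ (UniquelyColoured t φ A)) (edge-cone-indexOf S) (cf (indexOf {N} S))

-- Here t ≥ 2 is needed: a t-subset has a vertex other than the apex, which can be deleted.
cone-shrink : 2 ≤ t → ∀ {A s : Subset (suc N)} → zero ∈ A → s ⊆ A → ∣ s ∣ ≡ t →
  ∃ λ w → w ∈ s × zero ∈ A - w
cone-shrink t≥2 {s = s} 0∈A _ ∣s∣≡t with x , sx∈s ← 2≤∣p∣⇒∃suc∈p s (subst (2 ≤_) (sym ∣s∣≡t) t≥2)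
  = suc x , sx∈s , x∈p∧x≢y⇒x∈p-y 0∈A 0≢1+n

¬TSubsetCFColourable-cone : 2 ≤ t → t + k ≤ N → ¬ TSubsetCFColourable t (cone N) k
¬TSubsetCFColourable-cone {t} {k} {N} t≥2 t+k≤N (φ , cf) =
  <-irrefl refl (subst (k <_) (∣⊤∣≡n k) k<∣⊤∣)
  where
  k<∣⊤∣ : k < ∣ ⊤ {k} ∣
  k<∣⊤∣ = t-subset-colours-exceed φ (zero ∈_) (cone-uniquelyColoured cf) (cone-shrink t≥2)
    k {⊤} ⊤ here (s≤s (subst (t + k ≤_) (sym (∣⊤∣≡n N)) t+k≤N)) (λ _ _ → ∈⊤)

theorem1p9 : (t : ℕ) → 2 ≤ t →
    Σ (ℕ → Hypergraph) λ H →
      (∀ i → χCF≡ (H i) 2) ×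
      (∀ M → ∃ λ N → ∀ i → N ≤ i → χtCF≥ t (H i) M)
theorem1p9 t t≥2 = cone ∘ suc , χCF-cone , λ M → t + M , λ i t+M≤i k k<M →
  ¬TSubsetCFColourable-cone t≥2 (≤-trans (+-monoʳ-≤ t (<⇒≤ k<M)) (≤-trans t+M≤i (n≤1+n i)))
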